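{- Let $n$ be an odd prime, let $\overrightarrow{a}$ be the staircase array and $v_0\in\mathbb{Z}_n\times\mathbb{Z}_n$. Then the walk $W(v_0,\overrightarrow{a})$ in $K_n\Box K_n$ is a path of length $n(n-1)$.
   Context: $K_n \Box K_n$ has vertex set $\mathbb{Z}_n\times\mathbb{Z}_n$, with $(a,b)$ and $(c,d)$ adjacent iff they are distinct and $a=c$ or $b=d$. For an array $\overrightarrow{a}=[a_1,\dots,a_\ell]$ of elements of the form $(c,0)$ or $(0,c)$ with $c\neq 0$, $W(v_0,\overrightarrow{a})$ is the walk $v_0v_1\cdots v_\ell$ with $v_i=v_0+\sum_{g=1}^i a_g$. For odd $n$, the staircase array is the concatenation of the stretches $S_1,\dots,S_{(n-1)/2}$, where $S_k=[(0,2k-1),(2k-1,0),(0,2k-1),(2k-1,0),\dots,(0,2k-1),(2k,0)]$ has length $2n$: its $g$-th entry is $(0,2k-1)$ for odd $g$, $(2k-1,0)$ for even $g<2n$, and $(2k,0)$ for $g=2n$. Its total length is $n(n-1)$. -}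

module Defs where

open import Data.Nat using (ℕ; zero; suc; _+_; _*_; _∸_; _/_; NonZero)
open import Data.Nat.DivMod using (_mod_)
open import Data.Fin using (Fin; toℕ)
open import Data.Product using (_×_; _,_; proj₁; proj₂)
open import Data.Sum using (_⊎_)
open import Data.List using (List; []; _∷_; _++_; concatMap; applyUpTo; length)
open import Data.List.Relation.Unary.Linked using (Linked)
open import Data.List.Relation.Unary.AllPairs using (AllPairs)
open import Relation.Binary.PropositionalEquality using (_≡_; _≢_)
open import Relation.Nullary using (¬_)

-- ℤ_n represented by Fin n; vertices of K_n □ K_n.
Vertex : ℕ → Set
Vertex n = Fin n × Fin n

Adjacent : (n : ℕ) → Vertex n → Vertex n → Set
Adjacent n (a , b) (c , d) = ¬ ((a , b) ≡ (c , d)) × ((a ≡ c) ⊎ (b ≡ d))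

-- An array entry: (c,0) is  horiz c,  (0,c) is  vert c  (c read modulo n).
data Entry : Set where
  horiz : ℕ → Entry
  vert  : ℕ → Entry

step : (n : ℕ) .{{_ : NonZero n}} → Vertex n → Entry → Vertex n
step n (a , b) (horiz c) = ((toℕ a + c) mod n , b)
step n (a , b) (vert c)  = (a , (toℕ b + c) mod n)

walk : (n : ℕ) .{{_ : NonZero n}} → Vertex n → List Entry → List (Vertex n)
walk n v []       = v ∷ []
walk n v (e ∷ es) = v ∷ walk n (step n v e) es

-- stretch S_k of length 2n: entry g is (0,2k-1) for odd g, (2k-1,0) for even g < 2n,
-- and (2k,0) for g = 2n.  Written as (n-1) copies of [(0,2k-1),(2k-1,0)] followed by
-- [(0,2k-1),(2k,0)].
repeatPair : ℕ → Entry → Entry → List Entry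
repeatPair zero    x y = []
repeatPair (suc r) x y = x ∷ y ∷ repeatPair r x y

stretch : (n k : ℕ) → List Entry
stretch n k =
  repeatPair (n ∸ 1) (vert (2 * k ∸ 1)) (horiz (2 * k ∸ 1))
  ++ (vert (2 * k ∸ 1) ∷ horiz (2 * k) ∷ [])

staircase : ℕ → List Entry
staircase n = concatMap (stretch n) (applyUpTo suc ((n ∸ 1) / 2))

IsPath : (n : ℕ) → List (Vertex n) → Set
IsPath n vs = Linked (Adjacent n) vs × AllPairs _≢_ vs

walkLength : ∀ {A : Set} → List A → ℕ
walkLength xs = length xs ∸ 1

{-# OPTIONS --safe #-}
module Submission where

-- Write n = 2m + 1 and d = 2k + 1 for the step size of the stretch S_(k+1). Relative to v₀ this
-- stretch starts at (k, 0) and visits the stair corners (k + j d, j d) and (k + j d, (j + 1) d)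
-- for j < n; its final entry (d + 1, 0) lands on (k + 1, 0), since n d ≡ 0. The first minus the
-- second coordinate is k on the lower corners and −(k + 1) on the upper ones; these 2m + 1
-- residues are distinct, so they identify the stretch and the kind of a corner, and within such a
-- family the second coordinate j d determines j because d is invertible modulo the prime n.
-- Every entry lies strictly between 0 and n, so consecutive vertices are adjacent.

open import Defs
open import Data.Nat
  using (ℕ; zero; suc; pred; _+_; _*_; _∸_; _%_; _/_; _≤_; _<_; s≤s; z<s; NonZero; >-nonZero⁻¹)
open import Data.Nat.Properties
open import Data.Nat.DivMod
  using (_mod_; m≡m%n+[m/n]*n; %-distribˡ-+; m%n%n≡m%n; [m+n]%n≡m%n; [m+kn]%n≡m%n; m<n⇒m%n≡m;
         %-remove-+ʳ; m*n/n≡m)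
open import Data.Nat.Divisibility using (_∣_; _∤_; >⇒∤; m%n≡0⇒n∣m)
open import Data.Nat.Primality using (Prime; euclidsLemma)
import Data.Nat.Tactic.RingSolver as NatSolver
open import Data.Fin using (Fin; toℕ)
open import Data.Fin.Properties using (toℕ-injective; toℕ-fromℕ<; toℕ<n)
open import Data.Product using (Σ; ∃-syntax; _×_; _,_; proj₁; proj₂)
open import Data.Sum using (_⊎_; inj₁; inj₂)
open import Data.Empty using (⊥-elim)
open import Data.List using (List; []; _∷_; _++_; concatMap; applyUpTo; length)
open import Data.List.Properties using (length-++; ++-assoc; length-applyUpTo)
open import Data.List.Relation.Unary.All as All using (All; []; _∷_)
import Data.List.Relation.Unary.All.Properties as Allₚ
open import Data.List.Relation.Unary.Linked using (Linked; []; [-]; _∷_)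
open import Data.List.Relation.Unary.AllPairs using (AllPairs; []; _∷_)
open import Relation.Binary.PropositionalEquality
  using (_≡_; _≢_; refl; sym; trans; cong; cong₂; subst; subst₂; module ≡-Reasoning)

data Enumerated {A : Set} (R : ℕ → A → Set) : ℕ → List A → Set where
  []  : ∀ {i} → Enumerated R i []
  _∷_ : ∀ {i x xs} → R i x → Enumerated R (suc i) xs → Enumerated R i (x ∷ xs)

module _ {A : Set} {R : ℕ → A → Set} where

  enumerated-later : ∀ {i xs} → Enumerated R i xs → All (λ x → ∃[ j ] i ≤ j × R j x) xs
  enumerated-later []       = []
  enumerated-later (r ∷ rs) =
    (_ , ≤-refl , r) ∷ All.map (λ (j , i<j , r′) → j , <⇒≤ i<j , r′) (enumerated-later rs)

  enumerated⇒distinct : (∀ {i j x} → R i x → R j x → i ≡ j) →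
                        ∀ {i xs} → Enumerated R i xs → AllPairs _≢_ xs
  enumerated⇒distinct unique []       = []
  enumerated⇒distinct unique (r ∷ rs) =
    All.map (λ { (j , i<j , r′) refl → <-irrefl (unique r r′) i<j }) (enumerated-later rs)
      ∷ enumerated⇒distinct unique rs

applyUpTo-cong : ∀ {A : Set} {f g : ℕ → A} → (∀ i → f i ≡ g i) →
                 ∀ r → applyUpTo f r ≡ applyUpTo g r
applyUpTo-cong f≗g zero    = refl
applyUpTo-cong f≗g (suc r) = cong₂ _∷_ (f≗g 0) (applyUpTo-cong (λ i → f≗g (suc i)) r)

repeatPair⁺ : ∀ {P : Entry → Set} {x y} r → P x → P y → All P (repeatPair r x y)
repeatPair⁺ zero    px py = []
repeatPair⁺ (suc r) px py = px ∷ py ∷ repeatPair⁺ r px py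

length-repeatPair : ∀ r x y → length (repeatPair r x y) ≡ r * 2
length-repeatPair zero    x y = refl
length-repeatPair (suc r) x y = cong (2 +_) (length-repeatPair r x y)

odd⇒≡1+2m : ∀ {n} → n % 2 ≡ 1 → ∃[ m ] n ≡ suc (m + m)
odd⇒≡1+2m {n} odd = n / 2 , (begin
  n                    ≡⟨ m≡m%n+[m/n]*n n 2 ⟩
  n % 2 + n / 2 * 2    ≡⟨ cong₂ _+_ odd (*-comm (n / 2) 2) ⟩
  1 + 2 * (n / 2)      ≡⟨ cong (λ t → suc (n / 2 + t)) (+-identityʳ (n / 2)) ⟩
  suc (n / 2 + n / 2)  ∎)
  where open ≡-Reasoning

module Congruence (n : ℕ) .{{_ : NonZero n}} where

  infix 4 _≋_ _≋²_

  _≋_ : ℕ → ℕ → Set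
  a ≋ b = a % n ≡ b % n

  _≋²_ : ℕ × ℕ → ℕ × ℕ → Set
  (p , q) ≋² (p′ , q′) = p ≋ p′ × q ≋ q′

  ≋-+ : ∀ {a b c d} → a ≋ b → c ≋ d → a + c ≋ b + d
  ≋-+ {a} {b} {c} {d} a≋b c≋d = begin
    (a + c) % n          ≡⟨ %-distribˡ-+ a c n ⟩
    (a % n + c % n) % n  ≡⟨ cong₂ (λ x y → (x + y) % n) a≋b c≋d ⟩
    (b % n + d % n) % n  ≡⟨ %-distribˡ-+ b d n ⟨
    (b + d) % n          ∎
    where open ≡-Reasoning

  +-cancelˡ-≋ : ∀ c {a b} → c + a ≋ c + b → a ≋ b
  +-cancelˡ-≋ c {a} {b} eq = begin
    a % n                     ≡⟨ [m+kn]%n≡m%n a c n ⟨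
    (a + c * n) % n           ≡⟨ cong (_% n) (regroup a) ⟩
    (c + a + c * pred n) % n  ≡⟨ ≋-+ eq refl ⟩
    (c + b + c * pred n) % n  ≡⟨ cong (_% n) (regroup b) ⟨
    (b + c * n) % n           ≡⟨ [m+kn]%n≡m%n b c n ⟩
    b % n                     ∎
    where
    open ≡-Reasoning
    regroup : ∀ x → x + c * n ≡ c + x + c * pred n
    regroup x = begin
      x + c * n             ≡⟨ cong (λ t → x + c * t) (suc-pred n) ⟨
      x + c * suc (pred n)  ≡⟨ cong (x +_) (*-suc c (pred n)) ⟩
      x + (c + c * pred n)  ≡⟨ +-assoc x c _ ⟨
      x + c + c * pred n    ≡⟨ cong (_+ c * pred n) (+-comm x c) ⟩
      c + x + c * pred n    ∎

  ≋⇒≡ : ∀ {a b} → a < n → b < n → a ≋ b → a ≡ b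
  ≋⇒≡ a<n b<n a≋b = trans (sym (m<n⇒m%n≡m a<n)) (trans a≋b (m<n⇒m%n≡m b<n))

  private
    n∣difference : ∀ {a b d} → a ≤ b → a * d ≋ b * d → n ∣ (b ∸ a) * d
    n∣difference {a} {b} {d} a≤b eq = m%n≡0⇒n∣m _ n (sym (begin
      0                  ≡⟨ m<n⇒m%n≡m (>-nonZero⁻¹ n) ⟨
      0 % n              ≡⟨ +-cancelˡ-≋ (a * d) (begin
        (a * d + 0) % n            ≡⟨ cong (_% n) (+-identityʳ (a * d)) ⟩
        (a * d) % n                ≡⟨ eq ⟩
        (b * d) % n                ≡⟨ cong (λ t → (t * d) % n) (m+[n∸m]≡n a≤b) ⟨
        ((a + (b ∸ a)) * d) % n    ≡⟨ cong (_% n) (*-distribʳ-+ d a (b ∸ a)) ⟩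
        (a * d + (b ∸ a) * d) % n  ∎) ⟩
      ((b ∸ a) * d) % n  ∎))
      where open ≡-Reasoning

    *-cancelʳ-≋-≤ : Prime n → ∀ {d} → n ∤ d → ∀ {a b} → a ≤ b → a * d ≋ b * d → a ≋ b
    *-cancelʳ-≋-≤ p n∤d {a} {b} a≤b eq with euclidsLemma (b ∸ a) _ p (n∣difference a≤b eq)
    ... | inj₁ n∣b∸a = trans (sym (%-remove-+ʳ a n∣b∸a)) (cong (_% n) (m+[n∸m]≡n a≤b))
    ... | inj₂ n∣d   = ⊥-elim (n∤d n∣d)

  *-cancelʳ-≋ : Prime n → ∀ a b {d} → n ∤ d → a * d ≋ b * d → a ≋ b
  *-cancelʳ-≋ p a b n∤d eq with ≤-total a b
  ... | inj₁ a≤b = *-cancelʳ-≋-≤ p n∤d a≤b eq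
  ... | inj₂ b≤a = sym (*-cancelʳ-≋-≤ p n∤d b≤a (sym eq))

module Grid (n : ℕ) .{{_ : NonZero n}} where
  open Congruence n

  infixl 6 _⊕_
  _⊕_ : Vertex n → ℕ × ℕ → Vertex n
  (a , b) ⊕ (p , q) = ((toℕ a + p) mod n , (toℕ b + q) mod n)

  private
    mod-cong : ∀ {a b} → a ≋ b → a mod n ≡ b mod n
    mod-cong a≋b = toℕ-injective (trans (toℕ-fromℕ< _) (trans a≋b (sym (toℕ-fromℕ< _))))

    mod-injective : ∀ {a b} → a mod n ≡ b mod n → a ≋ b
    mod-injective eq = trans (sym (toℕ-fromℕ< _)) (trans (cong toℕ eq) (toℕ-fromℕ< _))

    toℕ-mod-+ : ∀ x c → toℕ (x mod n) + c ≋ x + c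
    toℕ-mod-+ x c = trans (cong (λ t → (t + c) % n) (toℕ-fromℕ< _)) (≋-+ (m%n%n≡m%n x n) refl)

  ⊕-identityʳ : ∀ v → v ⊕ (0 , 0) ≡ v
  ⊕-identityʳ (a , b) = cong₂ _,_ (mod-+0 a) (mod-+0 b)
    where
    mod-+0 : (i : Fin n) → (toℕ i + 0) mod n ≡ i
    mod-+0 i = toℕ-injective (trans (toℕ-fromℕ< _)
                 (trans (cong (_% n) (+-identityʳ (toℕ i))) (m<n⇒m%n≡m (toℕ<n i))))

  ⊕-cong : ∀ v {p q} → p ≋² q → v ⊕ p ≡ v ⊕ q
  ⊕-cong (a , b) (p≋ , q≋) = cong₂ _,_ (mod-cong (≋-+ refl p≋)) (mod-cong (≋-+ refl q≋))

  ⊕-cancelˡ : ∀ v {p q} → v ⊕ p ≡ v ⊕ q → p ≋² q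
  ⊕-cancelˡ (a , b) eq = +-cancelˡ-≋ (toℕ a) (mod-injective (cong proj₁ eq))
                       , +-cancelˡ-≋ (toℕ b) (mod-injective (cong proj₂ eq))

  step-horiz-⊕ : ∀ v p q c → step n (v ⊕ (p , q)) (horiz c) ≡ v ⊕ (p + c , q)
  step-horiz-⊕ (a , b) p q c =
    cong (_, _) (mod-cong (trans (toℕ-mod-+ (toℕ a + p) c) (cong (_% n) (+-assoc (toℕ a) p c))))

  step-vert-⊕ : ∀ v p q c → step n (v ⊕ (p , q)) (vert c) ≡ v ⊕ (p , q + c)
  step-vert-⊕ (a , b) p q c =
    cong (_ ,_) (mod-cong (trans (toℕ-mod-+ (toℕ b + q) c) (cong (_% n) (+-assoc (toℕ b) q c))))

  amount : Entry → ℕ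
  amount (horiz c) = c
  amount (vert c)  = c

  Nontrivial : Entry → Set
  Nontrivial e = 0 < amount e × amount e < n

  shift : Entry → ℕ × ℕ
  shift (horiz c) = (c , 0)
  shift (vert c)  = (0 , c)

  step≡⊕shift : ∀ v e → step n v e ≡ v ⊕ shift e
  step≡⊕shift v (horiz c) =
    trans (cong (λ w → step n w (horiz c)) (sym (⊕-identityʳ v))) (step-horiz-⊕ v 0 0 c)
  step≡⊕shift v (vert c) =
    trans (cong (λ w → step n w (vert c)) (sym (⊕-identityʳ v))) (step-vert-⊕ v 0 0 c)

  step-moves : ∀ v e → Nontrivial e → v ≢ step n v e
  step-moves v e (0<c , c<n) eq =
    <-irrefl (≋⇒≡ (>-nonZero⁻¹ n) c<n (0≋amount e (⊕-cancelˡ v ⊕0≡⊕shift))) 0<c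
    where
    0≋amount : ∀ e → (0 , 0) ≋² shift e → 0 ≋ amount e
    0≋amount (horiz c) = proj₁
    0≋amount (vert c)  = proj₂
    ⊕0≡⊕shift : v ⊕ (0 , 0) ≡ v ⊕ shift e
    ⊕0≡⊕shift = trans (⊕-identityʳ v) (trans eq (step≡⊕shift v e))

  step-adjacent : ∀ v e → Nontrivial e → Adjacent n v (step n v e)
  step-adjacent (a , b) e@(horiz c) p = step-moves (a , b) e p , inj₂ refl
  step-adjacent (a , b) e@(vert c)  p = step-moves (a , b) e p , inj₁ refl

  walk-linked : ∀ v es → All Nontrivial es → Linked (Adjacent n) (walk n v es)
  walk-linked v []            []       = [-]
  walk-linked v (e ∷ [])      (p ∷ []) = step-adjacent v e p ∷ [-]
  walk-linked v (e ∷ e′ ∷ es) (p ∷ ps) = step-adjacent v e p ∷ walk-linked (step n v e) (e′ ∷ es) ps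

  length-walk : ∀ v es → length (walk n v es) ≡ suc (length es)
  length-walk v []       = refl
  length-walk v (e ∷ es) = cong suc (length-walk (step n v e) es)

module Staircase (m : ℕ) (n-prime : Prime (suc (m + m))) where

  n : ℕ
  n = suc (m + m)

  open Congruence n
  open Grid n

  m<n : m < n
  m<n = s≤s (m≤m+n m m)

  rise : ℕ → ℕ
  rise k = suc (k + k)

  2[1+k]∸1≡rise : ∀ k → 2 * suc k ∸ 1 ≡ rise k
  2[1+k]∸1≡rise k = trans (+-suc k (k + 0)) (cong (λ t → suc (k + t)) (+-identityʳ k))

  1+rise<n : ∀ {k} → k < m → suc (rise k) < n
  1+rise<n {k} k<m = s≤s (subst (_≤ m + m) (cong suc (+-suc k k)) (+-mono-≤ k<m k<m))

  rise<n : ∀ {k} → k < m → rise k < n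
  rise<n k<m = <-trans (n<1+n _) (1+rise<n k<m)

  stairs : ℕ → ℕ → List Entry → List Entry
  stairs r k rest = repeatPair r (vert (rise k)) (horiz (rise k)) ++ vert (rise k) ∷ horiz (suc (rise k)) ∷ rest

  stretch≡stairs : ∀ k → stretch n (suc k) ≡ stairs (m + m) k []
  stretch≡stairs k =
    cong (λ c → repeatPair (m + m) (vert c) (horiz c) ++ vert c ∷ horiz (suc c) ∷ []) (2[1+k]∸1≡rise k)

  staircase≡ : staircase n ≡ concatMap (stretch n) (applyUpTo suc m)
  staircase≡ = cong (λ r → concatMap (stretch n) (applyUpTo suc r)) (begin
    (m + m) / 2  ≡⟨ cong (λ t → (m + t) / 2) (+-identityʳ m) ⟨
    2 * m / 2    ≡⟨ cong (_/ 2) (*-comm 2 m) ⟩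
    m * 2 / 2    ≡⟨ m*n/n≡m m 2 ⟩
    m            ∎)
    where open ≡-Reasoning

  -- The corners of the stretch S_(k+1); the walk ends at lower m 0.
  data Corner : Set where
    lower upper : ℕ → ℕ → Corner

  position : Corner → ℕ × ℕ
  position (lower k j) = (k + j * rise k , j * rise k)
  position (upper k j) = (k + j * rise k , suc j * rise k)

  Valid : Corner → Set
  Valid (lower k j) = (k < m × j < n) ⊎ (k ≡ m × j ≡ 0)
  Valid (upper k j) = k < m × j < n

  index : Corner → ℕ
  index (lower k j) = (k * n + j) * 2
  index (upper k j) = suc ((k * n + j) * 2)

  -- n ∸ suc k stands for −(k + 1) ≡ k − rise k.
  diagonal : Corner → ℕ
  diagonal (lower k j) = k
  diagonal (upper k j) = n ∸ suc k

  position-diagonal : ∀ {ℓ} → Valid ℓ → proj₁ (position ℓ) ≋ proj₂ (position ℓ) + diagonal ℓ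
  position-diagonal {lower k j} _ = cong (_% n) (+-comm k (j * rise k))
  position-diagonal {upper k j} (k<m , _) = sym (begin
    (suc j * rise k + (n ∸ suc k)) % n  ≡⟨ cong (_% n) (regroup (n ∸ suc k) k (j * rise k)) ⟩
    (x + (n ∸ suc k + suc k)) % n       ≡⟨ cong (λ t → (x + t) % n) (m∸n+n≡m (<-trans k<m m<n)) ⟩
    (x + n) % n                         ≡⟨ [m+n]%n≡m%n x n ⟩
    x % n                               ∎)
    where
    open ≡-Reasoning
    x = k + j * rise k
    regroup : ∀ t k x → suc (k + k) + x + t ≡ k + x + (t + suc k)
    regroup = NatSolver.solve-∀

  diagonal<n : ∀ {ℓ} → Valid ℓ → diagonal ℓ < n
  diagonal<n {lower k j} (inj₁ (k<m , _)) = <-trans k<m m<n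
  diagonal<n {lower k j} (inj₂ (refl , _)) = m<n
  diagonal<n {upper k j} (k<m , _) = ∸-monoʳ-< z<s (<-trans k<m m<n)

  diagonal-cong : ∀ {ℓ ℓ′} → Valid ℓ → Valid ℓ′ → position ℓ ≋² position ℓ′ →
                  diagonal ℓ ≡ diagonal ℓ′
  diagonal-cong {ℓ} {ℓ′} v v′ (first≋ , second≋) =
    ≋⇒≡ (diagonal<n v) (diagonal<n v′) (+-cancelˡ-≋ (proj₂ (position ℓ)) (begin
      (proj₂ (position ℓ) + diagonal ℓ) % n    ≡⟨ position-diagonal v ⟨
      proj₁ (position ℓ) % n                   ≡⟨ first≋ ⟩
      proj₁ (position ℓ′) % n                  ≡⟨ position-diagonal v′ ⟩
      (proj₂ (position ℓ′) + diagonal ℓ′) % n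
        ≡⟨ ≋-+ {proj₂ (position ℓ′)} {proj₂ (position ℓ)} {diagonal ℓ′} (sym second≋) refl ⟩
      (proj₂ (position ℓ) + diagonal ℓ′) % n   ∎))
    where open ≡-Reasoning

  height-injective : ∀ {k j j′} → k < m → j < n → j′ < n → j * rise k ≋ j′ * rise k → j ≡ j′
  height-injective {k} {j} {j′} k<m j<n j′<n eq =
    ≋⇒≡ j<n j′<n (*-cancelʳ-≋ n-prime j j′ (>⇒∤ (rise<n k<m)) eq)

  valid-lower⇒k≤m : ∀ {k j} → Valid (lower k j) → k ≤ m
  valid-lower⇒k≤m (inj₁ (k<m , _)) = <⇒≤ k<m
  valid-lower⇒k≤m (inj₂ (refl , _)) = ≤-refl

  m<upper-diagonal : ∀ {k} → k < m → m < n ∸ suc k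
  m<upper-diagonal {k} k<m = m+n≤o⇒m≤o∸n (suc m) (s≤s (+-monoʳ-≤ m k<m))

  same-diagonal⇒≡ : ∀ {ℓ ℓ′} → Valid ℓ → Valid ℓ′ → diagonal ℓ ≡ diagonal ℓ′ →
                    proj₂ (position ℓ) ≋ proj₂ (position ℓ′) → ℓ ≡ ℓ′
  same-diagonal⇒≡ {lower k j} {lower _ j′} (inj₁ (k<m , j<n)) (inj₁ (_ , j′<n)) refl h =
    cong (lower k) (height-injective k<m j<n j′<n h)
  same-diagonal⇒≡ {lower _ _} {lower _ _} (inj₁ (k<m , _)) (inj₂ (k≡m , _)) refl _ =
    ⊥-elim (<-irrefl k≡m k<m)
  same-diagonal⇒≡ {lower _ _} {lower _ _} (inj₂ (k≡m , _)) (inj₁ (k<m , _)) refl _ =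
    ⊥-elim (<-irrefl k≡m k<m)
  same-diagonal⇒≡ {lower _ _} {lower _ _} (inj₂ (_ , refl)) (inj₂ (_ , refl)) refl _ = refl
  same-diagonal⇒≡ {upper k j} {upper k′ j′} (k<m , j<n) (k′<m , j′<n) eq h
    with suc-injective (∸-cancelˡ-≡ (<-trans k<m m<n) (<-trans k′<m m<n) eq)
  ... | refl = cong (upper k) (height-injective k<m j<n j′<n (+-cancelˡ-≋ (rise k) h))
  same-diagonal⇒≡ {lower _ _} {upper _ _} v (k′<m , _) eq _ =
    ⊥-elim (<⇒≱ (m<upper-diagonal k′<m) (subst (_≤ m) eq (valid-lower⇒k≤m v)))
  same-diagonal⇒≡ {upper _ _} {lower _ _} (k<m , _) v′ eq _ =
    ⊥-elim (<⇒≱ (m<upper-diagonal k<m) (subst (_≤ m) (sym eq) (valid-lower⇒k≤m v′)))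

  position-injective : ∀ {ℓ ℓ′} → Valid ℓ → Valid ℓ′ → position ℓ ≋² position ℓ′ → ℓ ≡ ℓ′
  position-injective v v′ eq = same-diagonal⇒≡ v v′ (diagonal-cong v v′ eq) (proj₂ eq)

  module _ (v₀ : Vertex n) where

    corner : Corner → Vertex n
    corner ℓ = v₀ ⊕ position ℓ

    IndexedCorner : ℕ → Vertex n → Set
    IndexedCorner i v = Σ Corner λ ℓ → Valid ℓ × index ℓ ≡ i × corner ℓ ≡ v

    indexedCorner-unique : ∀ {i j v} → IndexedCorner i v → IndexedCorner j v → i ≡ j
    indexedCorner-unique (ℓ , valid , refl , refl) (ℓ′ , valid′ , refl , eq)
      with position-injective valid valid′ (⊕-cancelˡ v₀ (sym eq))
    ... | refl = refl

    EnumeratedWalk : Corner → List Entry → Set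
    EnumeratedWalk ℓ es = Enumerated IndexedCorner (index ℓ) (walk n (corner ℓ) es)

    visit : ∀ ℓ e ℓ′ {es} → Valid ℓ → step n (corner ℓ) e ≡ corner ℓ′ → suc (index ℓ) ≡ index ℓ′ →
            EnumeratedWalk ℓ′ es → EnumeratedWalk ℓ (e ∷ es)
    visit ℓ e ℓ′ valid stepped indexed rest = (ℓ , valid , refl , refl) ∷
      subst₂ (λ i v → Enumerated IndexedCorner i (walk n v _)) (sym indexed) (sym stepped) rest

    step-up : ∀ k j → step n (corner (lower k j)) (vert (rise k)) ≡ corner (upper k j)
    step-up k j = trans (step-vert-⊕ v₀ _ _ (rise k))
      (cong (λ t → v₀ ⊕ (k + j * rise k , t)) (+-comm (j * rise k) (rise k)))

    step-across : ∀ k j → step n (corner (upper k j)) (horiz (rise k)) ≡ corner (lower k (suc j))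
    step-across k j = trans (step-horiz-⊕ v₀ _ _ (rise k))
      (cong (λ t → v₀ ⊕ (t , suc j * rise k))
        (trans (+-assoc k (j * rise k) (rise k)) (cong (k +_) (+-comm (j * rise k) (rise k)))))

    step-to-next-stretch : ∀ k j → suc j ≡ n →
      step n (corner (upper k j)) (horiz (suc (rise k))) ≡ corner (lower (suc k) 0)
    step-to-next-stretch k j 1+j≡n = trans (step-horiz-⊕ v₀ _ _ _) (⊕-cong v₀ (first , second))
      where
      open ≡-Reasoning
      d = rise k
      full : suc j * d ≡ d * n
      full = trans (cong (_* d) 1+j≡n) (*-comm n d)
      regroup : ∀ k j d → k + j * d + suc d ≡ suc k + suc j * d
      regroup = NatSolver.solve-∀
      first : k + j * d + suc d ≋ suc k + 0
      first = begin
        (k + j * d + suc d) % n  ≡⟨ cong (_% n) (trans (regroup k j d) (cong (suc k +_) full)) ⟩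
        (suc k + d * n) % n      ≡⟨ [m+kn]%n≡m%n (suc k) d n ⟩
        suc k % n                ≡⟨ cong (_% n) (+-identityʳ (suc k)) ⟨
        (suc k + 0) % n          ∎
      second : suc j * d ≋ 0
      second = trans (cong (_% n) full) ([m+kn]%n≡m%n 0 d n)

    index-across : ∀ k j → suc (index (upper k j)) ≡ index (lower k (suc j))
    index-across k j = cong (_* 2) (sym (+-suc (k * n) j))

    index-to-next-stretch : ∀ k j → suc j ≡ n → suc (index (upper k j)) ≡ index (lower (suc k) 0)
    index-to-next-stretch k j 1+j≡n = cong (_* 2) (begin
      suc (k * n + j)  ≡⟨ +-suc (k * n) j ⟨
      k * n + suc j    ≡⟨ cong (k * n +_) 1+j≡n ⟩
      k * n + n        ≡⟨ +-comm (k * n) n ⟩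
      suc k * n        ≡⟨ +-identityʳ (suc k * n) ⟨
      suc k * n + 0    ∎)
      where open ≡-Reasoning

    climb : ∀ {k} r j → k < m → j + suc r ≡ n → ∀ {rest} →
            EnumeratedWalk (lower (suc k) 0) rest → EnumeratedWalk (lower k j) (stairs r k rest)
    climb {k} zero j k<m j+1≡n {rest} next =
      visit (lower k j) (vert (rise k)) (upper k j) {horiz (suc (rise k)) ∷ rest}
        (inj₁ (k<m , j<n)) (step-up k j) refl
        (visit (upper k j) (horiz (suc (rise k))) (lower (suc k) 0)
          (k<m , j<n) (step-to-next-stretch k j 1+j≡n) (index-to-next-stretch k j 1+j≡n) next)
      where
      1+j≡n = trans (+-comm 1 j) j+1≡n
      j<n = subst (j <_) 1+j≡n ≤-refl
    climb {k} (suc r) j k<m j+r≡n {rest} next =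
      visit (lower k j) (vert (rise k)) (upper k j) {horiz (rise k) ∷ _}
        (inj₁ (k<m , j<n)) (step-up k j) refl
        (visit (upper k j) (horiz (rise k)) (lower k (suc j))
          (k<m , j<n) (step-across k j) (index-across k j)
          (climb r (suc j) k<m (trans (sym (+-suc j (suc r))) j+r≡n) next))
      where
      j<n = subst (j <_) j+r≡n (m<m+n j z<s)

    stretch-walk : ∀ {k} → k < m → ∀ {rest} → EnumeratedWalk (lower (suc k) 0) rest →
                   EnumeratedWalk (lower k 0) (stretch n (suc k) ++ rest)
    stretch-walk {k} k<m {rest} next =
      subst (EnumeratedWalk (lower k 0)) (sym stretch-++) (climb (m + m) 0 k<m refl next)
      where
      stretch-++ : stretch n (suc k) ++ rest ≡ stairs (m + m) k rest
      stretch-++ = trans (cong (_++ rest) (stretch≡stairs k)) (++-assoc (repeatPair (m + m) _ _) _ rest)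

    stretches-walk : ∀ r k → r + k ≡ m →
                     EnumeratedWalk (lower k 0) (concatMap (stretch n) (applyUpTo (λ i → suc (i + k)) r))
    stretches-walk zero    k refl   = (lower m 0 , inj₂ (refl , refl) , refl , refl) ∷ []
    stretches-walk (suc r) k r+k≡m  = stretch-walk (subst (k <_) r+k≡m (m<n+m k z<s))
      (subst (EnumeratedWalk (lower (suc k) 0))
        (cong (concatMap (stretch n)) (applyUpTo-cong (λ i → cong suc (+-suc i k)) r))
        (stretches-walk r (suc k) (trans (+-suc r k) r+k≡m)))

    staircase-distinct : AllPairs _≢_ (walk n v₀ (staircase n))
    staircase-distinct = enumerated⇒distinct indexedCorner-unique
      (subst₂ (λ v es → Enumerated IndexedCorner 0 (walk n v es))
        (⊕-identityʳ v₀)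
        (trans (cong (concatMap (stretch n)) (applyUpTo-cong (λ i → cong suc (+-identityʳ i)) m))
               (sym staircase≡))
        (stretches-walk m 0 (+-identityʳ m)))

  staircase-nontrivial : All Nontrivial (staircase n)
  staircase-nontrivial = subst (All Nontrivial) (sym staircase≡)
    (Allₚ.concat⁺ (Allₚ.map⁺ (Allₚ.applyUpTo⁺₁ suc m stretch-nontrivial)))
    where
    stretch-nontrivial : ∀ {k} → k < m → All Nontrivial (stretch n (suc k))
    stretch-nontrivial k<m = subst (All Nontrivial) (sym (stretch≡stairs _))
      (Allₚ.++⁺ (repeatPair⁺ (m + m) stair stair) (stair ∷ (z<s , 1+rise<n k<m) ∷ []))
      where
      stair = z<s , rise<n k<m

  staircase-length : length (staircase n) ≡ n * (n ∸ 1)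
  staircase-length = begin
    length (staircase n)                              ≡⟨ cong length staircase≡ ⟩
    length (concatMap (stretch n) (applyUpTo suc m))  ≡⟨ length-stretches (applyUpTo suc m) ⟩
    length (applyUpTo suc m) * (n * 2)                ≡⟨ cong (_* (n * 2)) (length-applyUpTo suc m) ⟩
    m * (n * 2)                                       ≡⟨ regroup m ⟩
    n * (m + m)                                       ∎
    where
    open ≡-Reasoning
    length-stretch : ∀ k → length (stretch n k) ≡ n * 2
    length-stretch k = trans (length-++ (repeatPair (m + m) _ _))
      (trans (cong (_+ 2) (length-repeatPair (m + m) _ _)) (+-comm ((m + m) * 2) 2))
    length-stretches : ∀ ks → length (concatMap (stretch n) ks) ≡ length ks * (n * 2)
    length-stretches []       = refl
    length-stretches (k ∷ ks) =
      trans (length-++ (stretch n k)) (cong₂ _+_ (length-stretch k) (length-stretches ks))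
    regroup : ∀ m → m * (suc (m + m) * 2) ≡ suc (m + m) * (m + m)
    regroup = NatSolver.solve-∀

  staircase-path : (v₀ : Vertex n) →
    IsPath n (walk n v₀ (staircase n)) × walkLength (walk n v₀ (staircase n)) ≡ n * (n ∸ 1)
  staircase-path v₀ =
    (walk-linked v₀ (staircase n) staircase-nontrivial , staircase-distinct v₀) ,
    trans (cong (_∸ 1) (length-walk v₀ (staircase n))) staircase-length

proposition13 : (n : ℕ) .{{_ : NonZero n}} → Prime n → n % 2 ≡ 1 →
    (v₀ : Vertex n) →
    IsPath n (walk n v₀ (staircase n))
      × walkLength (walk n v₀ (staircase n)) ≡ n * (n ∸ 1)
proposition13 n n-prime odd v₀ with odd⇒≡1+2m {n} odd
... | m , refl = Staircase.staircase-path m n-prime v₀
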